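{- Every formula of $\mathrm{PL}_{\vee}(\mathrm{NE})$ is convex and union closed.
   Context: Fix a countably infinite set $\mathsf P$ of letters; a team over $\mathsf X\subseteq\mathsf P$ is a set of valuations $v:\mathsf X\to\{0,1\}$. $\mathrm{PL}_\vee$: $\alpha::=p\mid\bot\mid\alpha\wedge\alpha\mid\alpha\vee\alpha\mid\neg\alpha$; $\mathrm{PL}_\vee(\mathrm{NE})$: $\varphi::=p\mid\bot\mid\varphi\wedge\varphi\mid\varphi\vee\varphi\mid\neg\alpha\mid\mathrm{NE}$ with $\alpha\in\mathrm{PL}_\vee$. Truth: $t\models p$ iff $v(p)=1$ for all $v\in t$; $t\models\bot$ iff $t=\emptyset$; $t\models\neg\alpha$ iff $\{v\}\not\models\alpha$ for all $v\in t$; $\wedge$ as usual; $t\models\varphi\vee\psi$ iff $t=s\cup u$ for some $s\models\varphi$, $u\models\psi$; $t\models\mathrm{NE}$ iff $t\neq\emptyset$. A formula $\varphi$ is convex if $s\models\varphi$, $t\models\varphi$, $s\subseteq u\subseteq t$ imply $u\models\varphi$; union closed if for every nonempty set $\mathcal T$ of teams with $t\models\varphi$ for all $t\in\mathcal T$, $\bigcup\mathcal T\models\varphi$. -}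

module Defs where

open import Data.Nat using (ℕ)
open import Level using (Lift; suc; zero)
open import Data.Bool using (Bool; true)
open import Data.Product using (Σ; ∃; _×_; _,_)
open import Data.Sum using (_⊎_)
open import Data.Empty using (⊥)
open import Data.Unit using (⊤)
open import Relation.Nullary using (¬_)
open import Relation.Binary.PropositionalEquality using (_≡_)

Letter : Set
Letter = ℕ

Domain : Set₁
Domain = Letter → Set

Val : Domain → Set
Val X = (p : Letter) → X p → Bool

Team : Domain → Set₁
Team X = Val X → Set

module _ {X : Domain} where

  _⊆_ : Team X → Team X → Set
  s ⊆ t = ∀ v → s v → t v

  _≐_ : Team X → Team X → Set
  s ≐ t = s ⊆ t × t ⊆ s

  _∪_ : Team X → Team X → Team X
  (s ∪ u) v = s v ⊎ u v

  -- the singleton team {v} (valuations compared pointwise)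
  ⟦_⟧ : Val X → Team X
  ⟦ v ⟧ w = ∀ p (h : _) → w p h ≡ v p h

  IsEmpty : Team X → Set
  IsEmpty t = ∀ v → ¬ t v

  NonEmpty : Team X → Set
  NonEmpty t = ∃ λ v → t v

data PL : Set where
  var  : Letter → PL
  bot  : PL
  _∧_  : PL → PL → PL
  _∨_  : PL → PL → PL
  neg  : PL → PL

data PLNE : Set where
  var  : Letter → PLNE
  bot  : PLNE
  _∧_  : PLNE → PLNE → PLNE
  _∨_  : PLNE → PLNE → PLNE
  neg  : PL → PLNE
  NE   : PLNE

LettersInPL : Domain → PL → Set
LettersInPL X (var p) = X p
LettersInPL X bot = ⊤
LettersInPL X (a ∧ b) = LettersInPL X a × LettersInPL X b
LettersInPL X (a ∨ b) = LettersInPL X a × LettersInPL X b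
LettersInPL X (neg a) = LettersInPL X a

LettersIn : Domain → PLNE → Set
LettersIn X (var p) = X p
LettersIn X bot = ⊤
LettersIn X (a ∧ b) = LettersIn X a × LettersIn X b
LettersIn X (a ∨ b) = LettersIn X a × LettersIn X b
LettersIn X (neg a) = LettersInPL X a
LettersIn X NE = ⊤

_⊨ᶜ_ : {X : Domain} → Team X → PL → Set₁
t ⊨ᶜ var p = Lift (suc zero) (∀ v → t v → ∀ h → v p h ≡ true)
t ⊨ᶜ bot = Lift (suc zero) (IsEmpty t)
t ⊨ᶜ (a ∧ b) = t ⊨ᶜ a × t ⊨ᶜ b
_⊨ᶜ_ {X} t (a ∨ b) = Σ (Team X) λ s → Σ (Team X) λ u → Lift (suc zero) (t ≐ (s ∪ u)) × s ⊨ᶜ a × u ⊨ᶜ b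
t ⊨ᶜ neg a = ∀ v → t v → ¬ (⟦ v ⟧ ⊨ᶜ a)

_⊨_ : {X : Domain} → Team X → PLNE → Set₁
t ⊨ var p = Lift (suc zero) (∀ v → t v → ∀ h → v p h ≡ true)
t ⊨ bot = Lift (suc zero) (IsEmpty t)
t ⊨ (a ∧ b) = t ⊨ a × t ⊨ b
_⊨_ {X} t (a ∨ b) = Σ (Team X) λ s → Σ (Team X) λ u → Lift (suc zero) (t ≐ (s ∪ u)) × s ⊨ a × u ⊨ b
t ⊨ neg a = ∀ v → t v → ¬ (⟦ v ⟧ ⊨ᶜ a)
t ⊨ NE = Lift (suc zero) (NonEmpty t)

Convex : (X : Domain) → PLNE → Set₁
Convex X φ = (s t u : Team X) → s ⊨ φ → t ⊨ φ → s ⊆ u → u ⊆ t → u ⊨ φ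

-- Union closure: for every nonempty set of teams (given as a family indexed
-- by an inhabited type I) all satisfying φ, the union satisfies φ.
⋃ : {X : Domain} {I : Set} → (I → Team X) → Team X
⋃ {I = I} T v = Σ I λ i → T i v

UnionClosed : (X : Domain) → PLNE → Set₁
UnionClosed X φ = (I : Set) → I → (T : I → Team X) → (∀ i → T i ⊨ φ) → ⋃ T ⊨ φ

-- A formula is built from flat (downward closed and union closed) atoms and
-- the upward closed atom NE by ∧ and ∨, and all four constructions preserve
-- union closure, which is immediate. For convexity of φ ∨ ψ, if s ⊆ u ⊆ t
-- with s = s₁ ∪ s₂ and t = t₁ ∪ t₂ split along φ and ψ, then u splits as
-- (s₁ ∪ (u ∩ t₁)) ∪ (s₂ ∪ (u ∩ t₂)), and each part lies between sᵢ and
-- sᵢ ∪ tᵢ, which satisfies the disjunct by union closure.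
module Submission where

open import Defs
open import Data.Bool using (Bool; true; false; if_then_else_)
open import Data.Product using (_×_; _,_; proj₁; proj₂)
open import Data.Sum using (inj₁; inj₂)
open import Level using (lift; lower)

module _ {X : Domain} where

  _∩_ : Team X → Team X → Team X
  (s ∩ t) v = s v × t v

  ⋃-distrib-∪ : {I : Set} {T S U : I → Team X} →
                (∀ i → T i ≐ (S i ∪ U i)) → ⋃ T ≐ (⋃ S ∪ ⋃ U)
  ⋃-distrib-∪ {T = T} {S} {U} split = ⊆-∪ , ∪-⊆
    where
    ⊆-∪ : ⋃ T ⊆ (⋃ S ∪ ⋃ U)
    ⊆-∪ v (i , Tiv) with proj₁ (split i) v Tiv
    ... | inj₁ Siv = inj₁ (i , Siv)
    ... | inj₂ Uiv = inj₂ (i , Uiv)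
    ∪-⊆ : (⋃ S ∪ ⋃ U) ⊆ ⋃ T
    ∪-⊆ v (inj₁ (i , Siv)) = i , proj₂ (split i) v (inj₁ Siv)
    ∪-⊆ v (inj₂ (i , Uiv)) = i , proj₂ (split i) v (inj₂ Uiv)

  ∨-unionClosed : ∀ {φ ψ} → UnionClosed X φ → UnionClosed X ψ → UnionClosed X (φ ∨ ψ)
  ∨-unionClosed ucφ ucψ I i T T⊨ =
      ⋃ (λ j → proj₁ (T⊨ j)) , ⋃ (λ j → proj₁ (proj₂ (T⊨ j)))
    , lift (⋃-distrib-∪ (λ j → lower (proj₁ (proj₂ (proj₂ (T⊨ j))))))
    , ucφ I i _ (λ j → proj₁ (proj₂ (proj₂ (proj₂ (T⊨ j)))))
    , ucψ I i _ (λ j → proj₂ (proj₂ (proj₂ (proj₂ (T⊨ j)))))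

  unionClosed : ∀ φ → UnionClosed X φ
  unionClosed (var p) I i T T⊨ = lift λ { v (j , Tjv) → lower (T⊨ j) v Tjv }
  unionClosed bot     I i T T⊨ = lift λ { v (j , Tjv) → lower (T⊨ j) v Tjv }
  unionClosed (φ ∧ ψ) I i T T⊨ =
    unionClosed φ I i T (λ j → proj₁ (T⊨ j)) , unionClosed ψ I i T (λ j → proj₂ (T⊨ j))
  unionClosed (φ ∨ ψ) = ∨-unionClosed (unionClosed φ) (unionClosed ψ)
  unionClosed (neg α) I i T T⊨ v (j , Tjv) = T⊨ j v Tjv
  unionClosed NE      I i T T⊨ with lower (T⊨ i)
  ... | v , Tiv = lift (v , i , Tiv)

  ∪-closed : ∀ {φ s t} → UnionClosed X φ → s ⊨ φ → t ⊨ φ →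
             ⋃ (λ b → if b then s else t) ⊨ φ
  ∪-closed uc s⊨ t⊨ = uc Bool true _ λ { true → s⊨ ; false → t⊨ }

  ∨-convex : ∀ {φ ψ} → Convex X φ → Convex X ψ → UnionClosed X φ → UnionClosed X ψ →
             Convex X (φ ∨ ψ)
  ∨-convex cvφ cvψ ucφ ucψ s t u
           (s₁ , s₂ , lift (_ , s₁∪s₂⊆s) , s₁⊨ , s₂⊨) (t₁ , t₂ , lift (t⊆t₁∪t₂ , _) , t₁⊨ , t₂⊨)
           s⊆u u⊆t =
      u₁ , u₂ , lift (u⊆u₁∪u₂ , u₁∪u₂⊆u)
    , cvφ s₁ _ u₁ s₁⊨ (∪-closed ucφ s₁⊨ t₁⊨) (λ _ → inj₁) (between s₁ t₁)
    , cvψ s₂ _ u₂ s₂⊨ (∪-closed ucψ s₂⊨ t₂⊨) (λ _ → inj₁) (between s₂ t₂)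
    where
    u₁ u₂ : Team X
    u₁ = s₁ ∪ (u ∩ t₁)
    u₂ = s₂ ∪ (u ∩ t₂)
    between : ∀ sᵢ tᵢ → (sᵢ ∪ (u ∩ tᵢ)) ⊆ ⋃ (λ b → if b then sᵢ else tᵢ)
    between sᵢ tᵢ v (inj₁ sᵢv)      = true , sᵢv
    between sᵢ tᵢ v (inj₂ (_ , tᵢv)) = false , tᵢv
    u⊆u₁∪u₂ : u ⊆ (u₁ ∪ u₂)
    u⊆u₁∪u₂ v uv with t⊆t₁∪t₂ v (u⊆t v uv)
    ... | inj₁ t₁v = inj₁ (inj₂ (uv , t₁v))
    ... | inj₂ t₂v = inj₂ (inj₂ (uv , t₂v))
    u₁∪u₂⊆u : (u₁ ∪ u₂) ⊆ u
    u₁∪u₂⊆u v (inj₁ (inj₁ s₁v))     = s⊆u v (s₁∪s₂⊆s v (inj₁ s₁v))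
    u₁∪u₂⊆u v (inj₁ (inj₂ (uv , _))) = uv
    u₁∪u₂⊆u v (inj₂ (inj₁ s₂v))     = s⊆u v (s₁∪s₂⊆s v (inj₂ s₂v))
    u₁∪u₂⊆u v (inj₂ (inj₂ (uv , _))) = uv

  convex : ∀ φ → Convex X φ
  convex (var p) s t u _ t⊨ _ u⊆t = lift λ v uv → lower t⊨ v (u⊆t v uv)
  convex bot     s t u _ t⊨ _ u⊆t = lift λ v uv → lower t⊨ v (u⊆t v uv)
  convex (φ ∧ ψ) s t u s⊨ t⊨ s⊆u u⊆t =
    convex φ s t u (proj₁ s⊨) (proj₁ t⊨) s⊆u u⊆t , convex ψ s t u (proj₂ s⊨) (proj₂ t⊨) s⊆u u⊆t
  convex (φ ∨ ψ) = ∨-convex (convex φ) (convex ψ) (unionClosed φ) (unionClosed ψ)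
  convex (neg α) s t u _ t⊨ _ u⊆t v uv = t⊨ v (u⊆t v uv)
  convex NE      s t u s⊨ _ s⊆u _ with lower s⊨
  ... | v , sv = lift (v , s⊆u v sv)

proposition3p1 : (X : Domain) (φ : PLNE) → LettersIn X φ → Convex X φ × UnionClosed X φ
proposition3p1 X φ _ = convex φ , unionClosed φ
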